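{- Let $p$ be an odd prime, let $\Delta\in\mathbb{Z}$ with $\Delta\equiv3\pmod4$ be a quadratic non-residue modulo $p$, let $\mathfrak{p}=p\mathbb{Z}[\sqrt{\Delta}]$, let $a_k=k+\sqrt{\Delta}$ for $0\le k\le p-1$, and let $B_p=\prod_{k=0}^{p-1}(1-a_k^{p-1})$. Then $B_p^{\frac{p-1}{2}}\equiv 1\pmod{\mathfrak{p}}$. -}

module Defs where

open import Data.Nat as ℕ using (ℕ; zero; suc)
open import Data.Integer as ℤ using (ℤ; +_; _+_; _-_; _*_)
open import Data.Integer.Divisibility using (_∣_)
open import Data.List using (List; foldr; map; upTo)
open import Data.Product using (_×_)

-- Elements of ℤ[√Δ] : a + b√Δ represented by the pair (a , b).
record ℤ√ : Set where
  constructor _+_√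
  field
    re : ℤ
    im : ℤ
open ℤ√ public

module _ (Δ : ℤ) where
  one√ : ℤ√
  one√ = (+ 1) + (+ 0) √

  sub√ : ℤ√ → ℤ√ → ℤ√
  sub√ x y = (re x - re y) + (im x - im y) √

  mul√ : ℤ√ → ℤ√ → ℤ√
  mul√ x y = (re x * re y + Δ * (im x * im y)) + (re x * im y + im x * re y) √

  pow√ : ℤ√ → ℕ → ℤ√
  pow√ x zero    = one√
  pow√ x (suc n) = mul√ x (pow√ x n)

  prod√ : List ℤ√ → ℤ√
  prod√ = foldr mul√ one√

_≡_mod𝔭[_] : ℤ√ → ℤ√ → ℕ → Set
x ≡ y mod𝔭[ p ] = ((+ p) ∣ (re x - re y)) × ((+ p) ∣ (im x - im y))

QuadNonResidue : ℤ → ℕ → Set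
QuadNonResidue Δ p = ∀ (x : ℤ) → ((+ p) ∣ (x * x - Δ)) → Data.Empty.⊥
  where import Data.Empty

a : ℕ → ℤ√
a k = (+ k) + (+ 1) √

B : ℤ → ℕ → ℤ√
B Δ p = prod√ Δ (map (λ k → sub√ Δ (one√ Δ) (pow√ Δ (a k) (p ℕ.∸ 1))) (upTo p))

module Submission where

-- We show B_p ≡ 1 (mod pℤ[√Δ]), so that every power
-- of B_p, in particular B_p^((p-1)/2), is ≡ 1.
--
-- Everything happens in the commutative ring R = ℤ[√Δ]/pℤ[√Δ] of characteristic p.
--  * Frobenius: p divides the inner binomial coefficients, so x ↦ xᵖ is additive on any
--    commutative semiring of characteristic p; it fixes the integers (Fermat).
--  * Factor theorem: a monic polynomial of degree n with n roots whose differences are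
--    cancellable is the product of its linear factors.  Applied to xᵖ - x with the roots
--    0, -1, …, -(p-1) this gives xᵖ - x = ∏_{k<p} (x + k) in R.
--  * Euler's criterion: E = Δ^h satisfies E² ≡ 1 by Fermat, and E ≡ 1 is impossible, for
--    then ∏ a_k = √Δᵖ - √Δ = 0 although its norm ∏ (k² - Δ) is prime to p.  Hence
--    √Δᵖ = -√Δ and a_kᵖ = k - √Δ.
--  * Then a_k (1 - a_k^(p-1)) = a_k - a_kᵖ = 2√Δ, so (∏ a_k) · B_p = (2√Δ)ᵖ = -2√Δ = ∏ a_k,
--    and -2√Δ is cancellable because p ∤ 2Δ; therefore B_p ≡ 1.

open import Defs
open import Algebra.Bundles using (CommutativeSemiring; CommutativeRing)
open import Algebra.Structures using (IsCommutativeRing)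
open import Data.Empty using (⊥-elim)
open import Data.Fin using (Fin; suc; fromℕ; inject₁)
open import Data.Fin.Patterns using (0F)
open import Data.Fin.Properties using (toℕ-fromℕ; toℕ-inject₁; toℕ<n)
open import Data.Integer as ℤ using (ℤ; +_; -[1+_]; 0ℤ; 1ℤ)
import Data.Integer.Properties as ℤ
open import Data.Integer.Divisibility.Signed as ℤ∣
  using (divides; ∣ᵤ⇒∣; ∣⇒∣ᵤ; ∣m∣n⇒∣m+n; ∣m⇒∣-m; ∣n⇒∣m*n; ∣m⇒∣m*n)
import Data.Integer.Tactic.RingSolver as ℤ-Solver
open import Data.List using (List; []; _∷_; foldr; map; length; replicate; upTo)
open import Data.List.Properties using (map-∘; map-upTo; length-map; length-upTo; length-replicate)
open import Data.List.Relation.Unary.All as All using (All; []; _∷_)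
import Data.List.Relation.Unary.All.Properties as All
open import Data.List.Relation.Unary.AllPairs using (AllPairs; []; _∷_)
open import Data.List.Relation.Unary.AllPairs.Properties using (applyUpTo⁺₁)
open import Data.Nat as ℕ using (ℕ; zero; suc; _<_; _∸_; _!; s≤s; z≤n)
import Data.Nat.Properties as ℕ
open import Data.Nat.Combinatorics using (_C_; nCn≡1; nCk≡n!/k![n-k]!; k![n∸k]!∣n!)
open import Data.Nat.DivMod using (m/n*n≡m)
open import Data.Nat.Divisibility as ℕ∣ using (divides)
open import Data.Nat.Primality using (Prime; euclidsLemma; ¬prime[0]; ¬prime[1]; prime⇒irreducible)
open import Data.Product using (∃-syntax; _,_)
open import Data.Sum as Sum using (_⊎_; inj₁; inj₂; [_,_]′)
open import Level using (0ℓ; _⊔_)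
open import Relation.Binary.PropositionalEquality as ≡ using (_≡_)
open import Relation.Nullary using (¬_)

prime∤! : ∀ {p} → Prime p → ∀ k → k < p → ¬ p ℕ∣.∣ k !
prime∤! p-prime zero    _     p∣1 = ¬prime[1] (≡.subst Prime (ℕ∣.∣1⇒≡1 p∣1) p-prime)
prime∤! p-prime (suc k) 1+k<p p∣k! with euclidsLemma (suc k) (k !) p-prime p∣k!
... | inj₁ p∣1+k  = ℕ.<⇒≱ 1+k<p (ℕ∣.∣⇒≤ p∣1+k)
... | inj₂ p∣k!′ = prime∤! p-prime k (ℕ.<-trans (ℕ.n<1+n k) 1+k<p) p∣k!′

prime∣! : ∀ {p} → Prime p → p ℕ∣.∣ p !
prime∣! {zero}  p-prime = ⊥-elim (¬prime[0] p-prime)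
prime∣! {suc m} _       = ℕ∣.m∣m*n (m !)

C*k!*[n∸k]!≡n! : ∀ {n k} → k ℕ.≤ n → (n C k) ℕ.* (k ! ℕ.* (n ∸ k) !) ≡ n !
C*k!*[n∸k]!≡n! {n} {k} k≤n = ≡.trans (≡.cong (ℕ._* (k ! ℕ.* (n ∸ k) !)) (nCk≡n!/k![n-k]! k≤n))
                                      (m/n*n≡m {{ℕ._!*_!≢0 k (n ∸ k)}} (k![n∸k]!∣n! k≤n))

-- p divides (p choose k) for 0 < k < p: p divides p! = (p choose k) · k! · (p-k)!
-- but neither k! nor (p-k)!.
prime∣C : ∀ {p} → Prime p → ∀ k → 0 < k → k < p → p ℕ∣.∣ p C k
prime∣C {p} p-prime k 0<k k<p with euclidsLemma (p C k) (k ! ℕ.* (p ∸ k) !) p-prime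
  (≡.subst (p ℕ∣.∣_) (≡.sym (C*k!*[n∸k]!≡n! (ℕ.<⇒≤ k<p))) (prime∣! p-prime))
... | inj₁ p∣C = p∣C
... | inj₂ p∣k![p∸k]! with euclidsLemma (k !) ((p ∸ k) !) p-prime p∣k![p∸k]!
...   | inj₁ p∣k!     = ⊥-elim (prime∤! p-prime k k<p p∣k!)
...   | inj₂ p∣[p∸k]! = ⊥-elim (prime∤! p-prime (p ∸ k) (ℕ.∸-monoʳ-< 0<k (ℕ.<⇒≤ k<p)) p∣[p∸k]!)

-- Frobenius ("freshman's dream"): in a commutative semiring of characteristic p,
-- (x + y)ᵖ = xᵖ + yᵖ, since all inner binomial coefficients are multiples of p.
module Frobenius {c ℓ} (S : CommutativeSemiring c ℓ) where
  open CommutativeSemiring S hiding (zero)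
  open import Algebra.Properties.CommutativeSemiring.Binomial S using (theorem; binomialTerm)
  open import Algebra.Properties.Semiring.Exp semiring using (_^_)
  open import Algebra.Properties.Semiring.Mult semiring using (_×_; ×-homo-1; ×-assoc-*; ×-congʳ; ×1-homo-*)
  open import Algebra.Properties.Monoid.Sum +-monoid
    using (sum; sum-init-last; sum-cong-≋; sum-replicate-zero)
  open import Relation.Binary.Reasoning.Setoid setoid

  char-multiple : ∀ {p} → p × 1# ≈ 0# → ∀ {n} x → p ℕ∣.∣ n → n × x ≈ 0#
  char-multiple {p} char x (divides q ≡.refl) = begin
    (q ℕ.* p) × x          ≈⟨ ×-congʳ (q ℕ.* p) (*-identityˡ x) ⟨
    (q ℕ.* p) × (1# * x)   ≈⟨ ×-assoc-* (q ℕ.* p) 1# x ⟨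
    ((q ℕ.* p) × 1#) * x   ≈⟨ *-congʳ (×1-homo-* q p) ⟩
    ((q × 1#) * (p × 1#)) * x ≈⟨ *-congʳ (*-congˡ char) ⟩
    ((q × 1#) * 0#) * x    ≈⟨ *-congʳ (zeroʳ (q × 1#)) ⟩
    0# * x                 ≈⟨ zeroˡ x ⟩
    0#                     ∎

  frobenius : ∀ {p} → Prime p → p × 1# ≈ 0# → ∀ x y → (x + y) ^ p ≈ x ^ p + y ^ p
  frobenius {zero}  p-prime _    x y = ⊥-elim (¬prime[0] p-prime)
  frobenius {suc m} p-prime char x y = begin
    (x + y) ^ suc m                                          ≈⟨ theorem (suc m) x y ⟩
    term 0F + sum (λ i → term (suc i))                       ≈⟨ +-congˡ (sum-init-last (λ i → term (suc i))) ⟩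
    term 0F + (sum (λ i → term (suc (inject₁ i))) + term (suc (fromℕ m)))
                                                             ≈⟨ +-cong bottom (+-cong middle top) ⟩
    y ^ suc m + (0# + x ^ suc m)                             ≈⟨ +-congˡ (+-identityˡ _) ⟩
    y ^ suc m + x ^ suc m                                    ≈⟨ +-comm _ _ ⟩
    x ^ suc m + y ^ suc m                                    ∎
    where
    term : Fin (suc (suc m)) → Carrier
    term = binomialTerm x y (suc m)
    bottom : term 0F ≈ y ^ suc m
    bottom = trans (×-homo-1 _) (*-identityˡ _)
    top : term (suc (fromℕ m)) ≈ x ^ suc m
    top rewrite toℕ-fromℕ m | nCn≡1 (suc m) | ℕ.n∸n≡0 m = trans (×-homo-1 _) (*-identityʳ _)
    middle : sum (λ i → term (suc (inject₁ i))) ≈ 0#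
    middle = trans (sum-cong-≋ inner) (sum-replicate-zero m)
      where
      inner : ∀ i → term (suc (inject₁ i)) ≈ 0#
      inner i = char-multiple char _ (prime∣C p-prime _ (s≤s z≤n)
                  (s≤s (≡.subst (_< m) (≡.sym (toℕ-inject₁ i)) (toℕ<n i))))

module CharacteristicP {c ℓ} (R : CommutativeRing c ℓ) where
  open CommutativeRing R hiding (zero)
  open import Algebra.Properties.Group +-group using (inverseʳ-unique)
  open import Algebra.Properties.Semiring.Exp semiring using (_^_; ^-congˡ)
  open import Algebra.Properties.Semiring.Mult semiring using (_×_)
  open Frobenius commutativeSemiring using (frobenius)
  open import Relation.Binary.Reasoning.Setoid setoid

  1^n≈1 : ∀ n → 1# ^ n ≈ 1#
  1^n≈1 zero    = refl
  1^n≈1 (suc n) = trans (*-identityˡ _) (1^n≈1 n)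

  0^p≈0 : ∀ {p} → Prime p → 0# ^ p ≈ 0#
  0^p≈0 {zero}  p-prime = ⊥-elim (¬prime[0] p-prime)
  0^p≈0 {suc m} _       = zeroˡ _

  module _ {p} (p-prime : Prime p) (char : p × 1# ≈ 0#) where

    frobenius-+ : ∀ x y → (x + y) ^ p ≈ x ^ p + y ^ p
    frobenius-+ = frobenius p-prime char

    -- xᵖ + (-x)ᵖ = (x - x)ᵖ = 0, so (-x)ᵖ is the additive inverse of xᵖ.
    frobenius-- : ∀ x → (- x) ^ p ≈ - (x ^ p)
    frobenius-- x = inverseʳ-unique (x ^ p) ((- x) ^ p) (begin
      x ^ p + (- x) ^ p ≈⟨ frobenius-+ x (- x) ⟨
      (x - x) ^ p       ≈⟨ ^-congˡ p (-‿inverseʳ x) ⟩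
      0# ^ p            ≈⟨ 0^p≈0 p-prime ⟩
      0#                ∎)

    fermat : ∀ n → (n × 1#) ^ p ≈ n × 1#
    fermat zero    = 0^p≈0 p-prime
    fermat (suc n) = begin
      (1# + n × 1#) ^ p     ≈⟨ frobenius-+ 1# (n × 1#) ⟩
      1# ^ p + (n × 1#) ^ p ≈⟨ +-cong (1^n≈1 p) (fermat n) ⟩
      1# + n × 1#           ∎

module ListProduct {c ℓ} (R : CommutativeRing c ℓ) where
  open CommutativeRing R hiding (zero)
  open import Algebra.Properties.Semiring.Exp semiring using (_^_)
  open import Algebra.Properties.CommutativeSemigroup *-commutativeSemigroup using (interchange)
  open import Relation.Binary.Reasoning.Setoid setoid

  product : List Carrier → Carrier
  product = foldr _*_ 1#

  module _ {a} {A : Set a} where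

    product-map-cong : ∀ {f g : A → Carrier} → (∀ k → f k ≈ g k) →
                       ∀ l → product (map f l) ≈ product (map g l)
    product-map-cong f≈g []      = refl
    product-map-cong f≈g (k ∷ l) = *-cong (f≈g k) (product-map-cong f≈g l)

    product-map-* : ∀ (f g : A → Carrier) l →
                    product (map (λ k → f k * g k) l) ≈ product (map f l) * product (map g l)
    product-map-* f g []      = sym (*-identityˡ 1#)
    product-map-* f g (k ∷ l) = trans (*-congˡ (product-map-* f g l)) (interchange (f k) (g k) _ _)

    product-map-const : ∀ t (l : List A) → product (map (λ _ → t) l) ≈ t ^ length l
    product-map-const t []      = refl
    product-map-const t (k ∷ l) = *-congˡ (product-map-const t l)

module MonicFactorisation {c ℓ} (R : CommutativeRing c ℓ) where
  open CommutativeRing R hiding (zero)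
  open import Algebra.Solver.Ring.NaturalCoefficients.Default commutativeSemiring
    using (solve; _:=_; _:+_; _:*_; con)
  open ListProduct R using (product)
  open import Algebra.Properties.Ring ring using (-1*x≈-x)
  open import Algebra.Properties.Semiring.Exp semiring using (_^_)
  open import Algebra.Properties.Group +-group using (//-rightDividesˡ)
  open import Relation.Binary.Reasoning.Setoid setoid

  -- The monic polynomial c₀ + c₁x + … + cₙ₋₁xⁿ⁻¹ + xⁿ, represented by its lower
  -- coefficients [c₀, …, cₙ₋₁] and evaluated by Horner's rule.
  monic : List Carrier → Carrier → Carrier
  monic []       x = 1#
  monic (c ∷ cs) x = c + x * monic cs x

  Cancellable : Carrier → Set (c ⊔ ℓ)
  Cancellable a = ∀ {x y} → a * x ≈ a * y → x ≈ y

  cancellable-factor : ∀ {u v c} → u * v ≈ c → Cancellable c → Cancellable v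
  cancellable-factor {u} {v} {c} uv≈c cancel {x} {y} vx≈vy = cancel (begin
    c * x       ≈⟨ *-congʳ uv≈c ⟨
    u * v * x   ≈⟨ *-assoc u v x ⟩
    u * (v * x) ≈⟨ *-congˡ vx≈vy ⟩
    u * (v * y) ≈⟨ *-assoc u v y ⟨
    u * v * y   ≈⟨ *-congʳ uv≈c ⟩
    c * y       ∎)

  -- Synthetic division by x - r: the coefficients of the monic quotient of the monic
  -- polynomial with lower coefficients (c ∷ cs).
  quotient : Carrier → List Carrier → List Carrier
  quotient r []       = []
  quotient r (d ∷ cs) = monic (d ∷ cs) r ∷ quotient r cs

  length-quotient : ∀ r cs → length (quotient r cs) ≡ length cs
  length-quotient r []       = ≡.refl
  length-quotient r (d ∷ cs) = ≡.cong suc (length-quotient r cs)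

  -- Division with remainder: f(x) = (x - r)·q(x) + f(r), stated for x = t + r.
  division : ∀ r t {x} → x ≈ t + r → ∀ c cs →
             monic (c ∷ cs) x ≈ t * monic (quotient r cs) x + monic (c ∷ cs) r
  division r t {x} x≈t+r c [] = begin
    c + x * 1#             ≈⟨ +-congˡ (*-congʳ x≈t+r) ⟩
    c + (t + r) * 1#       ≈⟨ solve 3 (λ c t r → c :+ (t :+ r) :* con 1 := t :* con 1 :+ (c :+ r :* con 1))
                                    refl c t r ⟩
    t * 1# + (c + r * 1#)  ∎
  division r t {x} x≈t+r c (d ∷ cs) = begin
    c + x * monic (d ∷ cs) x            ≈⟨ +-congˡ (*-cong x≈t+r (division r t x≈t+r d cs)) ⟩
    c + (t + r) * (t * Q + G)           ≈⟨ solve 5 (λ c t r Q G → c :+ (t :+ r) :* (t :* Q :+ G)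
                                                     := t :* (G :+ (t :+ r) :* Q) :+ (c :+ r :* G))
                                                   refl c t r Q G ⟩
    t * (G + (t + r) * Q) + (c + r * G) ≈⟨ +-congʳ (*-congˡ (+-congˡ (*-congʳ (sym x≈t+r)))) ⟩
    t * (G + x * Q) + (c + r * G)       ∎
    where
    Q G : Carrier
    Q = monic (quotient r cs) x
    G = monic (d ∷ cs) r

  x≈[x-r]+r : ∀ x r → x ≈ (x - r) + r
  x≈[x-r]+r x r = sym (//-rightDividesˡ r x)

  -- If r and r′ are roots of f and r′ - r is cancellable, then r′ is a root of the
  -- quotient of f by x - r: (r′ - r)·q(r′) = f(r′) - f(r) = 0.
  quotient-root : ∀ c cs {r r′} → monic (c ∷ cs) r ≈ 0# → monic (c ∷ cs) r′ ≈ 0# →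
                  Cancellable (r′ - r) → monic (quotient r cs) r′ ≈ 0#
  quotient-root c cs {r} {r′} fr≈0 fr′≈0 cancel = cancel (begin
    (r′ - r) * q                    ≈⟨ +-identityʳ _ ⟨
    (r′ - r) * q + 0#               ≈⟨ +-congˡ fr≈0 ⟨
    (r′ - r) * q + monic (c ∷ cs) r ≈⟨ division r (r′ - r) (x≈[x-r]+r r′ r) c cs ⟨
    monic (c ∷ cs) r′               ≈⟨ fr′≈0 ⟩
    0#                              ≈⟨ zeroʳ _ ⟨
    (r′ - r) * 0#                   ∎)
    where
    q : Carrier
    q = monic (quotient r cs) r′

  factorisation : ∀ f rs → length rs ≡ length f →
                  AllPairs (λ r r′ → Cancellable (r′ - r)) rs → All (λ r → monic f r ≈ 0#) rs →
                  ∀ x → monic f x ≈ product (map (λ r → x - r) rs)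
  factorisation []       []       _   []             []             x = refl
  factorisation (c ∷ cs) (r ∷ rs) len (dist ∷ dists) (root ∷ roots) x = begin
    monic (c ∷ cs) x                                     ≈⟨ division r (x - r) (x≈[x-r]+r x r) c cs ⟩
    (x - r) * monic (quotient r cs) x + monic (c ∷ cs) r ≈⟨ +-cong (*-congˡ factor-quotient) root ⟩
    (x - r) * product (map (λ r → x - r) rs) + 0#        ≈⟨ +-identityʳ _ ⟩
    (x - r) * product (map (λ r → x - r) rs)             ∎
    where
    quotient-roots : All (λ r′ → monic (quotient r cs) r′ ≈ 0#) rs
    quotient-roots = All.map (λ (cancel , root′) → quotient-root c cs root root′ cancel)
                             (All.zip (dist , roots))
    factor-quotient : monic (quotient r cs) x ≈ product (map (λ r → x - r) rs)
    factor-quotient = factorisation (quotient r cs) rs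
      (≡.trans (ℕ.suc-injective len) (≡.sym (length-quotient r cs))) dists quotient-roots x

  X^[2+m]-X : ℕ → List Carrier
  X^[2+m]-X m = 0# ∷ - 1# ∷ replicate m 0#

  monic-X^[2+m]-X : ∀ m x → monic (X^[2+m]-X m) x ≈ x ^ suc (suc m) - x
  monic-X^[2+m]-X m x = begin
    0# + x * (- 1# + x * monic (replicate m 0#) x) ≈⟨ +-identityˡ _ ⟩
    x * (- 1# + x * monic (replicate m 0#) x)      ≈⟨ *-congˡ (+-congˡ (*-congˡ (monic-xᵐ m))) ⟩
    x * (- 1# + x * x ^ m)                         ≈⟨ distribˡ x (- 1#) (x * x ^ m) ⟩
    x * - 1# + x ^ suc (suc m)                     ≈⟨ +-congʳ (trans (*-comm x (- 1#)) (-1*x≈-x x)) ⟩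
    - x + x ^ suc (suc m)                          ≈⟨ +-comm (- x) _ ⟩
    x ^ suc (suc m) - x                            ∎
    where
    monic-xᵐ : ∀ m → monic (replicate m 0#) x ≈ x ^ m
    monic-xᵐ zero    = refl
    monic-xᵐ (suc m) = trans (+-identityˡ _) (*-congˡ (monic-xᵐ m))

prime∣* : ∀ {p} → Prime p → ∀ m n → (+ p) ℤ∣.∣ (m ℤ.* n) → (+ p) ℤ∣.∣ m ⊎ (+ p) ℤ∣.∣ n
prime∣* {p} p-prime m n p∣mn
  with euclidsLemma ℤ.∣ m ∣ ℤ.∣ n ∣ p-prime (≡.subst (p ℕ∣.∣_) (ℤ.abs-* m n) (∣⇒∣ᵤ p∣mn))
... | inj₁ p∣m = inj₁ (∣ᵤ⇒∣ p∣m)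
... | inj₂ p∣n = inj₂ (∣ᵤ⇒∣ p∣n)

module IntegerCongruence (p : ℕ) where
  infix 4 _∼_
  record _∼_ (a b : ℤ) : Set where
    constructor mk∼
    field p∣a-b : (+ p) ℤ∣.∣ (a ℤ.- b)
  open _∼_ public

  _∣by_ : ∀ {a b} → (+ p) ℤ∣.∣ a → a ≡ b → (+ p) ℤ∣.∣ b
  d ∣by a≡b = ≡.subst ((+ p) ℤ∣.∣_) a≡b d

  ∼-refl : ∀ {a} → a ∼ a
  ∼-refl {a} = mk∼ (divides 0ℤ ≡.refl ∣by ≡.sym (ℤ.+-inverseʳ a))

  ∼-reflexive : ∀ {a b} → a ≡ b → a ∼ b
  ∼-reflexive ≡.refl = ∼-refl

  private
    sym-identity : ∀ a b → ℤ.- (a ℤ.- b) ≡ b ℤ.- a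
    sym-identity = ℤ-Solver.solve-∀
    trans-identity : ∀ a b c → (a ℤ.- b) ℤ.+ (b ℤ.- c) ≡ a ℤ.- c
    trans-identity = ℤ-Solver.solve-∀
    +-identity : ∀ a b c d → (a ℤ.- c) ℤ.+ (b ℤ.- d) ≡ (a ℤ.+ b) ℤ.- (c ℤ.+ d)
    +-identity = ℤ-Solver.solve-∀
    *-identity : ∀ a b c d → (a ℤ.- c) ℤ.* b ℤ.+ c ℤ.* (b ℤ.- d) ≡ a ℤ.* b ℤ.- c ℤ.* d
    *-identity = ℤ-Solver.solve-∀
    neg-identity : ∀ a b → ℤ.- (a ℤ.- b) ≡ ℤ.- a ℤ.- ℤ.- b
    neg-identity = ℤ-Solver.solve-∀

  ∼-sym : ∀ {a b} → a ∼ b → b ∼ a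
  ∼-sym {a} {b} (mk∼ d) = mk∼ (∣m⇒∣-m d ∣by sym-identity a b)

  ∼-trans : ∀ {a b c} → a ∼ b → b ∼ c → a ∼ c
  ∼-trans {a} {b} {c} (mk∼ d) (mk∼ d′) = mk∼ (∣m∣n⇒∣m+n d d′ ∣by trans-identity a b c)

  +-cong∼ : ∀ {a b c d} → a ∼ c → b ∼ d → a ℤ.+ b ∼ c ℤ.+ d
  +-cong∼ {a} {b} {c} {d} (mk∼ d₁) (mk∼ d₂) = mk∼ (∣m∣n⇒∣m+n d₁ d₂ ∣by +-identity a b c d)

  *-cong∼ : ∀ {a b c d} → a ∼ c → b ∼ d → a ℤ.* b ∼ c ℤ.* d
  *-cong∼ {a} {b} {c} {d} (mk∼ d₁) (mk∼ d₂) =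
    mk∼ (∣m∣n⇒∣m+n (∣m⇒∣m*n b d₁) (∣n⇒∣m*n c d₂) ∣by *-identity a b c d)

  -‿cong∼ : ∀ {a b} → a ∼ b → ℤ.- a ∼ ℤ.- b
  -‿cong∼ {a} {b} (mk∼ d) = mk∼ (∣m⇒∣-m d ∣by neg-identity a b)

  ∣⇒∼0 : ∀ {a} → (+ p) ℤ∣.∣ a → a ∼ 0ℤ
  ∣⇒∼0 {a} d = mk∼ (d ∣by ≡.sym (ℤ.+-identityʳ a))

  ∼0⇒∣ : ∀ {a} → a ∼ 0ℤ → (+ p) ℤ∣.∣ a
  ∼0⇒∣ {a} (mk∼ d) = d ∣by ℤ.+-identityʳ a

  -- Distinct residues 0 ≤ i < j < p are incongruent: p cannot divide 0 < j - i < p.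
  residues-distinct : ∀ {i j} → i ℕ.< j → j ℕ.< p → ¬ (+ j ∼ + i)
  residues-distinct {i} {j} i<j j<p (mk∼ p∣j-i) =
    ℕ.<⇒≱ (ℕ.≤-<-trans (ℕ.m∸n≤m j i) j<p) (ℕ∣.∣⇒≤ {{ℕ.>-nonZero (ℕ.m<n⇒0<n∸m i<j)}} p∣j∸i)
    where
    p∣j∸i : p ℕ∣.∣ (j ℕ.∸ i)
    p∣j∸i = ∣⇒∣ᵤ (p∣j-i ∣by ≡.trans (ℤ.[+m]-[+n]≡m⊖n j i) (ℤ.⊖-≥ (ℕ.<⇒≤ i<j)))

module QuadraticRing (Δ : ℤ) (p : ℕ) where
  open IntegerCongruence p public

  add√ : ℤ√ → ℤ√ → ℤ√
  add√ x y = (re x ℤ.+ re y) + (im x ℤ.+ im y) √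

  neg√ : ℤ√ → ℤ√
  neg√ x = (ℤ.- re x) + (ℤ.- im x) √

  zero√ : ℤ√
  zero√ = 0ℤ + 0ℤ √

  ext : ∀ {x y} → re x ≡ re y → im x ≡ im y → x ≡ y
  ext {a + b √} {.a + .b √} ≡.refl ≡.refl = ≡.refl

  private
    re-*-assoc : ∀ Δ a b c d e f → (a ℤ.* c ℤ.+ Δ ℤ.* (b ℤ.* d)) ℤ.* e ℤ.+ Δ ℤ.* ((a ℤ.* d ℤ.+ b ℤ.* c) ℤ.* f)
                                  ≡ a ℤ.* (c ℤ.* e ℤ.+ Δ ℤ.* (d ℤ.* f)) ℤ.+ Δ ℤ.* (b ℤ.* (c ℤ.* f ℤ.+ d ℤ.* e))
    re-*-assoc = ℤ-Solver.solve-∀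
    im-*-assoc : ∀ Δ a b c d e f → (a ℤ.* c ℤ.+ Δ ℤ.* (b ℤ.* d)) ℤ.* f ℤ.+ (a ℤ.* d ℤ.+ b ℤ.* c) ℤ.* e
                                  ≡ a ℤ.* (c ℤ.* f ℤ.+ d ℤ.* e) ℤ.+ b ℤ.* (c ℤ.* e ℤ.+ Δ ℤ.* (d ℤ.* f))
    im-*-assoc = ℤ-Solver.solve-∀
    re-*-identityˡ : ∀ Δ a b → 1ℤ ℤ.* a ℤ.+ Δ ℤ.* (0ℤ ℤ.* b) ≡ a
    re-*-identityˡ = ℤ-Solver.solve-∀
    im-*-identityˡ : ∀ a b → 1ℤ ℤ.* b ℤ.+ 0ℤ ℤ.* a ≡ b
    im-*-identityˡ = ℤ-Solver.solve-∀
    re-distribˡ : ∀ Δ a b c d e f → a ℤ.* (c ℤ.+ e) ℤ.+ Δ ℤ.* (b ℤ.* (d ℤ.+ f))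
                                   ≡ (a ℤ.* c ℤ.+ Δ ℤ.* (b ℤ.* d)) ℤ.+ (a ℤ.* e ℤ.+ Δ ℤ.* (b ℤ.* f))
    re-distribˡ = ℤ-Solver.solve-∀
    im-distribˡ : ∀ a b c d e f → a ℤ.* (d ℤ.+ f) ℤ.+ b ℤ.* (c ℤ.+ e)
                                 ≡ (a ℤ.* d ℤ.+ b ℤ.* c) ℤ.+ (a ℤ.* f ℤ.+ b ℤ.* e)
    im-distribˡ = ℤ-Solver.solve-∀
    re-*-comm : ∀ Δ a b c d → a ℤ.* c ℤ.+ Δ ℤ.* (b ℤ.* d) ≡ c ℤ.* a ℤ.+ Δ ℤ.* (d ℤ.* b)
    re-*-comm = ℤ-Solver.solve-∀
    im-*-comm : ∀ a b c d → a ℤ.* d ℤ.+ b ℤ.* c ≡ c ℤ.* b ℤ.+ d ℤ.* a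
    im-*-comm = ℤ-Solver.solve-∀

  module Laws where
    +-assoc : ∀ x y z → add√ (add√ x y) z ≡ add√ x (add√ y z)
    +-assoc x y z = ext (ℤ.+-assoc (re x) (re y) (re z)) (ℤ.+-assoc (im x) (im y) (im z))

    +-comm : ∀ x y → add√ x y ≡ add√ y x
    +-comm x y = ext (ℤ.+-comm (re x) (re y)) (ℤ.+-comm (im x) (im y))

    +-identityˡ : ∀ x → add√ zero√ x ≡ x
    +-identityˡ x = ext (ℤ.+-identityˡ (re x)) (ℤ.+-identityˡ (im x))

    +-identityʳ : ∀ x → add√ x zero√ ≡ x
    +-identityʳ x = ext (ℤ.+-identityʳ (re x)) (ℤ.+-identityʳ (im x))

    -‿inverseˡ : ∀ x → add√ (neg√ x) x ≡ zero√
    -‿inverseˡ x = ext (ℤ.+-inverseˡ (re x)) (ℤ.+-inverseˡ (im x))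

    -‿inverseʳ : ∀ x → add√ x (neg√ x) ≡ zero√
    -‿inverseʳ x = ext (ℤ.+-inverseʳ (re x)) (ℤ.+-inverseʳ (im x))

    *-assoc : ∀ x y z → mul√ Δ (mul√ Δ x y) z ≡ mul√ Δ x (mul√ Δ y z)
    *-assoc (a + b √) (c + d √) (e + f √) = ext (re-*-assoc Δ a b c d e f) (im-*-assoc Δ a b c d e f)

    *-comm : ∀ x y → mul√ Δ x y ≡ mul√ Δ y x
    *-comm (a + b √) (c + d √) = ext (re-*-comm Δ a b c d) (im-*-comm a b c d)

    *-identityˡ : ∀ x → mul√ Δ (one√ Δ) x ≡ x
    *-identityˡ (a + b √) = ext (re-*-identityˡ Δ a b) (im-*-identityˡ a b)

    *-identityʳ : ∀ x → mul√ Δ x (one√ Δ) ≡ x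
    *-identityʳ x = ≡.trans (*-comm x (one√ Δ)) (*-identityˡ x)

    distribˡ : ∀ x y z → mul√ Δ x (add√ y z) ≡ add√ (mul√ Δ x y) (mul√ Δ x z)
    distribˡ (a + b √) (c + d √) (e + f √) = ext (re-distribˡ Δ a b c d e f) (im-distribˡ a b c d e f)

    distribʳ : ∀ x y z → mul√ Δ (add√ y z) x ≡ add√ (mul√ Δ y x) (mul√ Δ z x)
    distribʳ x y z = ≡.trans (*-comm (add√ y z) x)
                       (≡.trans (distribˡ x y z) (≡.cong₂ add√ (*-comm x y) (*-comm x z)))

  infix 4 _≈_
  record _≈_ (x y : ℤ√) : Set where
    constructor mk≈
    field
      re∼ : re x ∼ re y
      im∼ : im x ∼ im y
  open _≈_ public

  ≈-reflexive : ∀ {x y} → x ≡ y → x ≈ y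
  ≈-reflexive ≡.refl = mk≈ ∼-refl ∼-refl

  isCommutativeRing : IsCommutativeRing _≈_ add√ (mul√ Δ) neg√ zero√ (one√ Δ)
  isCommutativeRing = record
    { isRing = record
      { +-isAbelianGroup = record
        { isGroup = record
          { isMonoid = record
            { isSemigroup = record
              { isMagma = record
                { isEquivalence = record
                  { refl  = mk≈ ∼-refl ∼-refl
                  ; sym   = λ (mk≈ r i) → mk≈ (∼-sym r) (∼-sym i)
                  ; trans = λ (mk≈ r i) (mk≈ r′ i′) → mk≈ (∼-trans r r′) (∼-trans i i′)
                  }
                ; ∙-cong = λ (mk≈ r i) (mk≈ r′ i′) → mk≈ (+-cong∼ r r′) (+-cong∼ i i′)
                }
              ; assoc = λ x y z → ≈-reflexive (Laws.+-assoc x y z)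
              }
            ; identity = (λ x → ≈-reflexive (Laws.+-identityˡ x)) , (λ x → ≈-reflexive (Laws.+-identityʳ x))
            }
          ; inverse = (λ x → ≈-reflexive (Laws.-‿inverseˡ x)) , (λ x → ≈-reflexive (Laws.-‿inverseʳ x))
          ; ⁻¹-cong = λ (mk≈ r i) → mk≈ (-‿cong∼ r) (-‿cong∼ i)
          }
        ; comm = λ x y → ≈-reflexive (Laws.+-comm x y)
        }
      ; *-cong = λ (mk≈ r i) (mk≈ r′ i′) →
                   mk≈ (+-cong∼ (*-cong∼ r r′) (*-cong∼ (∼-refl {Δ}) (*-cong∼ i i′)))
                       (+-cong∼ (*-cong∼ r i′) (*-cong∼ i r′))
      ; *-assoc = λ x y z → ≈-reflexive (Laws.*-assoc x y z)
      ; *-identity = (λ x → ≈-reflexive (Laws.*-identityˡ x)) , (λ x → ≈-reflexive (Laws.*-identityʳ x))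
      ; distrib = (λ x y z → ≈-reflexive (Laws.distribˡ x y z))
                , (λ x y z → ≈-reflexive (Laws.distribʳ x y z))
      }
    ; *-comm = λ x y → ≈-reflexive (Laws.*-comm x y)
    }

  ℤ[√Δ]/p : CommutativeRing 0ℓ 0ℓ
  ℤ[√Δ]/p = record { isCommutativeRing = isCommutativeRing }

module PrimeQuotient (Δ : ℤ) {p : ℕ} (p-prime : Prime p) where
  open QuadraticRing Δ p
  open CommutativeRing ℤ[√Δ]/p hiding (_≈_; zero)
  open import Algebra.Properties.Semiring.Exp semiring using (_^_; ^-congˡ)
  open import Algebra.Properties.Semiring.Mult semiring using (_×_)
  open MonicFactorisation ℤ[√Δ]/p using (Cancellable)
  open ListProduct ℤ[√Δ]/p using (product)
  open import Relation.Binary.Reasoning.Setoid setoid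

  ι : ℤ → ℤ√
  ι z = z + 0ℤ √

  private
    re-ι-* : ∀ Δ a b → a ℤ.* b ≡ a ℤ.* b ℤ.+ Δ ℤ.* (0ℤ ℤ.* 0ℤ)
    re-ι-* = ℤ-Solver.solve-∀
    im-ι-* : ∀ a b → 0ℤ ≡ a ℤ.* 0ℤ ℤ.+ 0ℤ ℤ.* b
    im-ι-* = ℤ-Solver.solve-∀

  ι-* : ∀ a b → ι (a ℤ.* b) ≈ ι a * ι b
  ι-* a b = ≈-reflexive (ext (re-ι-* Δ a b) (im-ι-* a b))

  ι-cong : ∀ {a b} → a ∼ b → ι a ≈ ι b
  ι-cong a∼b = mk≈ a∼b ∼-refl

  ι-injective : ∀ {a b} → ι a ≈ ι b → a ∼ b
  ι-injective = re∼

  ι-^ : ∀ a n → ι (a ℤ.^ n) ≈ ι a ^ n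
  ι-^ a zero    = refl
  ι-^ a (suc n) = trans (ι-* a (a ℤ.^ n)) (*-congˡ {ι a} (ι-^ a n))

  ×1≈ι : ∀ n → n × 1# ≈ ι (+ n)
  ×1≈ι zero    = refl
  ×1≈ι (suc n) = +-congˡ {1#} (×1≈ι n)

  char : p × 1# ≈ 0#
  char = trans (×1≈ι p) (ι-cong (∣⇒∼0 (ℤ∣.∣-refl)))

  open CharacteristicP ℤ[√Δ]/p using (fermat; frobenius--)

  fermat-ι : ∀ z → ι z ^ p ≈ ι z
  fermat-ι (+ n) = begin
    ι (+ n) ^ p   ≈⟨ ^-congˡ p (×1≈ι n) ⟨
    (n × 1#) ^ p  ≈⟨ fermat p-prime char n ⟩
    n × 1#        ≈⟨ ×1≈ι n ⟩
    ι (+ n)       ∎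
  fermat-ι -[1+ n ] = trans (frobenius-- p-prime char (ι (+ suc n))) (-‿cong (fermat-ι (+ suc n)))

  *-∼0 : ∀ a b → a ℤ.* b ∼ 0ℤ → a ∼ 0ℤ ⊎ b ∼ 0ℤ
  *-∼0 a b ab∼0 = Sum.map ∣⇒∼0 ∣⇒∼0 (prime∣* p-prime a b (∼0⇒∣ ab∼0))

  private
    re-ι-cancel : ∀ Δ c a b a′ b′ → (c ℤ.* a ℤ.+ Δ ℤ.* (0ℤ ℤ.* b)) ℤ.- (c ℤ.* a′ ℤ.+ Δ ℤ.* (0ℤ ℤ.* b′))
                                    ≡ c ℤ.* (a ℤ.- a′)
    re-ι-cancel = ℤ-Solver.solve-∀
    im-ι-cancel : ∀ c a b a′ b′ → (c ℤ.* b ℤ.+ 0ℤ ℤ.* a) ℤ.- (c ℤ.* b′ ℤ.+ 0ℤ ℤ.* a′) ≡ c ℤ.* (b ℤ.- b′)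
    im-ι-cancel = ℤ-Solver.solve-∀

  ι-cancellable : ∀ {c} → ¬ (c ∼ 0ℤ) → Cancellable (ι c)
  ι-cancellable {c} c≁0 {a + b √} {a′ + b′ √} (mk≈ (mk∼ re-dvd) (mk∼ im-dvd)) =
    mk≈ (cancel (re-dvd ∣by re-ι-cancel Δ c a b a′ b′)) (cancel (im-dvd ∣by im-ι-cancel c a b a′ b′))
    where
    cancel : ∀ {u v} → (+ p) ℤ∣.∣ c ℤ.* (u ℤ.- v) → u ∼ v
    cancel {u} {v} d with *-∼0 c (u ℤ.- v) (∣⇒∼0 d)
    ... | inj₁ c∼0   = ⊥-elim (c≁0 c∼0)
    ... | inj₂ u-v∼0 = mk∼ (∼0⇒∣ u-v∼0)

  N : ℤ√ → ℤ
  N x = re x ℤ.* re x ℤ.- Δ ℤ.* (im x ℤ.* im x)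

  private
    N-*-identity : ∀ Δ a b c d → (a ℤ.* c ℤ.+ Δ ℤ.* (b ℤ.* d)) ℤ.* (a ℤ.* c ℤ.+ Δ ℤ.* (b ℤ.* d))
                                   ℤ.- Δ ℤ.* ((a ℤ.* d ℤ.+ b ℤ.* c) ℤ.* (a ℤ.* d ℤ.+ b ℤ.* c))
                                 ≡ (a ℤ.* a ℤ.- Δ ℤ.* (b ℤ.* b)) ℤ.* (c ℤ.* c ℤ.- Δ ℤ.* (d ℤ.* d))
    N-*-identity = ℤ-Solver.solve-∀

  N-* : ∀ x y → N (x * y) ≡ N x ℤ.* N y
  N-* (a + b √) (c + d √) = N-*-identity Δ a b c d

  N-1 : N 1# ≡ 1ℤ
  N-1 = ≡.cong (λ t → 1ℤ ℤ.- t) (ℤ.*-zeroʳ Δ)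

  N-0 : N 0# ≡ 0ℤ
  N-0 = ≡.cong (λ t → 0ℤ ℤ.- t) (ℤ.*-zeroʳ Δ)

  N-cong : ∀ {x y} → x ≈ y → N x ∼ N y
  N-cong (mk≈ r i) = +-cong∼ (*-cong∼ r r) (-‿cong∼ (*-cong∼ (∼-refl {Δ}) (*-cong∼ i i)))

  NormUnit : ℤ√ → Set
  NormUnit x = ¬ (N x ∼ 0ℤ)

  NormUnit-1 : NormUnit 1#
  NormUnit-1 N1∼0 = ¬prime[1] (≡.subst Prime (ℕ∣.∣1⇒≡1 (ℤ∣.∣⇒∣ᵤ (∼0⇒∣ 1∼0))) p-prime)
    where
    1∼0 : 1ℤ ∼ 0ℤ
    1∼0 = ∼-trans (∼-reflexive (≡.sym N-1)) N1∼0

  NormUnit-* : ∀ {x y} → NormUnit x → NormUnit y → NormUnit (x * y)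
  NormUnit-* {x} {y} ux uy Nxy∼0 =
    [ ux , uy ]′ (*-∼0 (N x) (N y) (∼-trans (∼-reflexive (≡.sym (N-* x y))) Nxy∼0))

  NormUnit⇒≉0 : ∀ {x} → NormUnit x → ¬ (x ≈ 0#)
  NormUnit⇒≉0 ux x≈0 = ux (∼-trans (N-cong x≈0) (∼-reflexive N-0))

  NormUnit-product : ∀ {xs} → All NormUnit xs → NormUnit (product xs)
  NormUnit-product {[]}     []         = NormUnit-1
  NormUnit-product {x ∷ xs} (ux ∷ uxs) = NormUnit-* {x} {product xs} ux (NormUnit-product uxs)

  pow√≡^ : ∀ x n → pow√ Δ x n ≡ x ^ n
  pow√≡^ x zero    = ≡.refl
  pow√≡^ x (suc n) = ≡.cong (x *_) (pow√≡^ x n)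

module OddPrime (Δ : ℤ) (h' : ℕ) where
  h : ℕ
  h = suc h'

  p : ℕ
  p = suc (h ℕ.+ h)

  open QuadraticRing Δ p

  p≰2 : ¬ p ℕ.≤ 2
  p≰2 (s≤s (s≤s h'+h≤0)) = ℕ.m+1+n≢0 h' (ℕ.n≤0⇒n≡0 h'+h≤0)

  private
    difference-of-squares : ∀ e → e ℤ.* e ℤ.- 1ℤ ≡ (e ℤ.- 1ℤ) ℤ.* (e ℤ.+ 1ℤ)
    difference-of-squares = ℤ-Solver.solve-∀
    negated-difference : ∀ a b → ℤ.- (ℤ.- b ℤ.- ℤ.- a) ≡ b ℤ.- a
    negated-difference = ℤ-Solver.solve-∀

  module _ (p-prime : Prime p) (nonresidue : ∀ x → ¬ (x ℤ.* x ∼ Δ)) where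
    open CommutativeRing ℤ[√Δ]/p hiding (_≈_; zero)
    open PrimeQuotient Δ p-prime
    open ListProduct ℤ[√Δ]/p
    open MonicFactorisation ℤ[√Δ]/p
    open CharacteristicP ℤ[√Δ]/p using (frobenius-+; 1^n≈1)
    open import Algebra.Properties.Semiring.Exp semiring using (_^_; ^-congˡ; ^-homo-*)
    open import Algebra.Properties.CommutativeSemiring.Exp commutativeSemiring using (^-distrib-*)
    open import Algebra.Properties.Ring ring using (-‿distribʳ-*; x[y-z]≈xy-xz)
    open import Relation.Binary.Reasoning.Setoid setoid

    Δ≁0 : ¬ (Δ ∼ 0ℤ)
    Δ≁0 Δ∼0 = nonresidue 0ℤ (∼-sym Δ∼0)

    s : ℤ√
    s = 0ℤ + 1ℤ √

    s*s≈Δ : s * s ≈ ι Δ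
    s*s≈Δ = ≈-reflexive (ext (≡.trans (ℤ.+-identityˡ _) (ℤ.*-identityʳ Δ)) ≡.refl)

    -- The polynomial xᵖ - x (recall p = (h' + h) + 2) and its roots ρ 0, …, ρ (p-1),
    -- where ρ k = -k; the roots are distinct modulo p and their differences cancellable.
    xᵖ-x : List ℤ√
    xᵖ-x = X^[2+m]-X (h' ℕ.+ h)

    ρ : ℕ → ℤ√
    ρ k = ι (ℤ.- (+ k))

    roots : List ℤ√
    roots = map ρ (upTo p)

    -- ρ j - ρ i = i - j is prime to p.
    ρ-distinct : ∀ {i j} → i ℕ.< j → j ℕ.< p → Cancellable (ρ j - ρ i)
    ρ-distinct {i} {j} i<j j<p = ι-cancellable {ℤ.- (+ j) ℤ.- ℤ.- (+ i)} (λ ρj-ρi∼0 →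
      residues-distinct i<j j<p (mk∼ (∣m⇒∣-m (∼0⇒∣ ρj-ρi∼0) ∣by negated-difference (+ i) (+ j))))

    roots-distinct : AllPairs (λ r r′ → Cancellable (r′ - r)) roots
    roots-distinct = ≡.subst (AllPairs _) (≡.sym (map-upTo ρ p)) (applyUpTo⁺₁ ρ p ρ-distinct)

    -- Fermat: every integer is a root of xᵖ - x.
    roots-are-roots : All (λ r → monic xᵖ-x r ≈ 0#) roots
    roots-are-roots = All.map⁺ (All.universal (λ k → root (ℤ.- (+ k))) (upTo p))
      where
      root : ∀ z → monic xᵖ-x (ι z) ≈ 0#
      root z = begin
        monic xᵖ-x (ι z) ≈⟨ monic-X^[2+m]-X (h' ℕ.+ h) (ι z) ⟩
        ι z ^ p - ι z    ≈⟨ +-congʳ { - ι z} (fermat-ι z) ⟩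
        ι z - ι z        ≈⟨ -‿inverseʳ (ι z) ⟩
        0#               ∎

    length-roots : length roots ≡ length xᵖ-x
    length-roots = ≡.trans (length-map ρ (upTo p))
      (≡.trans (length-upTo p) (≡.cong (λ n → suc (suc n)) (≡.sym (length-replicate (h' ℕ.+ h)))))

    shifted-product : ∀ x → product (map (λ k → x + ι (+ k)) (upTo p)) ≈ x ^ p - x
    shifted-product x = begin
      product (map (λ k → x + ι (+ k)) (upTo p))
        ≈⟨ product-map-cong (λ k → +-congˡ {x} (ι-cong (∼-reflexive (≡.sym (ℤ.neg-involutive (+ k))))))
                            (upTo p) ⟩
      product (map (λ k → x - ρ k) (upTo p))
        ≡⟨ ≡.cong product (map-∘ {g = λ r → x - r} {f = ρ} (upTo p)) ⟩
      product (map (λ r → x - r) roots)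
        ≈⟨ factorisation xᵖ-x roots length-roots roots-distinct roots-are-roots x ⟨
      monic xᵖ-x x
        ≈⟨ monic-X^[2+m]-X (h' ℕ.+ h) x ⟩
      x ^ p - x ∎

    E : ℤ
    E = Δ ℤ.^ h

    s^p≈s*E : s ^ p ≈ s * ι E
    s^p≈s*E = *-congˡ {s} (begin
      s ^ (h ℕ.+ h) ≈⟨ ^-homo-* s h h ⟩
      s ^ h * s ^ h ≈⟨ ^-distrib-* s s h ⟨
      (s * s) ^ h   ≈⟨ ^-congˡ h s*s≈Δ ⟩
      ι Δ ^ h       ≈⟨ ι-^ Δ h ⟨
      ι E           ∎)

    -- E² ≡ 1, because Δ · E² = Δᵖ ≡ Δ by Fermat and Δ is cancellable.
    E²∼1 : E ℤ.* E ∼ 1ℤ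
    E²∼1 = ι-injective (ι-cancellable Δ≁0 (begin
      ι Δ * ι (E ℤ.* E)         ≈⟨ *-congˡ {ι Δ} (trans (ι-* E E) (*-cong (ι-^ Δ h) (ι-^ Δ h))) ⟩
      ι Δ * (ι Δ ^ h * ι Δ ^ h) ≈⟨ *-congˡ {ι Δ} (^-homo-* (ι Δ) h h) ⟨
      ι Δ ^ p                   ≈⟨ fermat-ι Δ ⟩
      ι Δ                       ≈⟨ *-identityʳ (ι Δ) ⟨
      ι Δ * ι 1ℤ                ∎))

    -- a_k = k + √Δ has norm k² - Δ ≢ 0 (mod p), as Δ is not a square modulo p.
    a-unit : ∀ k → NormUnit (a k)
    a-unit k Na∼0 = nonresidue (+ k) (mk∼ (∼0⇒∣ (∼-trans (∼-reflexive k²-Δ≡Na) Na∼0)))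
      where
      k²-Δ≡Na : + k ℤ.* + k ℤ.- Δ ≡ N (a k)
      k²-Δ≡Na = ≡.cong (λ t → + k ℤ.* + k ℤ.- t) (≡.sym (ℤ.*-identityʳ Δ))

    -- P = ∏_{k<p} a_k = √Δᵖ - √Δ, and P ≢ 0 since its norm is a unit.
    P : ℤ√
    P = product (map a (upTo p))

    P≈s^p-s : P ≈ s ^ p - s
    P≈s^p-s = shifted-product s

    P≉0 : ¬ (P ≈ 0#)
    P≉0 = NormUnit⇒≉0 {P} (NormUnit-product (All.map⁺ {f = a} (All.universal a-unit (upTo p))))

    -- E ≢ 1: otherwise √Δᵖ = √Δ, i.e. P ≡ 0.
    E≁1 : ¬ (E ∼ 1ℤ)
    E≁1 E∼1 = P≉0 (begin
      P          ≈⟨ P≈s^p-s ⟩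
      s ^ p - s  ≈⟨ +-congʳ { - s} (trans s^p≈s*E (trans (*-congˡ {s} (ι-cong E∼1)) (*-identityʳ s))) ⟩
      s - s      ≈⟨ -‿inverseʳ s ⟩
      0#         ∎)

    -- Euler's criterion for the non-residue Δ: Δ^h ≡ -1, as E² ≡ 1 forces E ≡ ±1.
    euler : E ∼ ℤ.-1ℤ
    euler = [ (λ E-1∼0 → ⊥-elim (E≁1 (mk∼ (∼0⇒∣ E-1∼0)))) , (λ E+1∼0 → mk∼ (∼0⇒∣ E+1∼0)) ]′
              (*-∼0 (E ℤ.- 1ℤ) (E ℤ.+ 1ℤ) (∣⇒∼0 (p∣a-b E²∼1 ∣by difference-of-squares E)))

    s^p≈-s : s ^ p ≈ - s
    s^p≈-s = begin
      s ^ p        ≈⟨ s^p≈s*E ⟩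
      s * ι E      ≈⟨ *-congˡ {s} (ι-cong euler) ⟩
      s * - 1#     ≈⟨ -‿distribʳ-* s 1# ⟨
      - (s * 1#)   ≈⟨ -‿cong (*-identityʳ s) ⟩
      - s          ∎

    -- Frobenius conjugates a_k = √Δ + k: a_kᵖ = -√Δ + k.
    a^p≈conj : ∀ k → a k ^ p ≈ - s + ι (+ k)
    a^p≈conj k = trans (frobenius-+ p-prime char s (ι (+ k))) (+-cong s^p≈-s (fermat-ι (+ k)))

    b : ℕ → ℤ√
    b k = sub√ Δ (one√ Δ) (pow√ Δ (a k) (p ℕ.∸ 1))

    -- a_k b_k = a_k - a_kᵖ = 2√Δ (the last step is a coordinatewise computation).
    a*b≈2s : ∀ k → a k * b k ≈ s + s
    a*b≈2s k = begin
      a k * (1# - pow√ Δ (a k) (h ℕ.+ h)) ≡⟨ ≡.cong (λ t → a k * (1# - t)) (pow√≡^ (a k) (h ℕ.+ h)) ⟩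
      a k * (1# - a k ^ (h ℕ.+ h))        ≈⟨ x[y-z]≈xy-xz (a k) 1# _ ⟩
      a k * 1# - a k ^ p                  ≈⟨ +-cong (*-identityʳ (a k)) (-‿cong (a^p≈conj k)) ⟩
      (s + ι (+ k)) - (- s + ι (+ k))     ≈⟨ ≈-reflexive (ext (ℤ.+-inverseʳ (+ k)) ≡.refl) ⟩
      s + s                               ∎

    P*B≈-2s : P * B Δ p ≈ - s + - s
    P*B≈-2s = begin
      P * B Δ p                                ≈⟨ product-map-* a b (upTo p) ⟨
      product (map (λ k → a k * b k) (upTo p)) ≈⟨ product-map-cong a*b≈2s (upTo p) ⟩
      product (map (λ _ → s + s) (upTo p))     ≈⟨ product-map-const (s + s) (upTo p) ⟩
      (s + s) ^ length (upTo p)                ≡⟨ ≡.cong ((s + s) ^_) (length-upTo p) ⟩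
      (s + s) ^ p                              ≈⟨ frobenius-+ p-prime char s s ⟩
      s ^ p + s ^ p                            ≈⟨ +-cong s^p≈-s s^p≈-s ⟩
      - s + - s                                ∎

    P≈-2s : P ≈ - s + - s
    P≈-2s = trans P≈s^p-s (+-congʳ { - s} s^p≈-s)

    -- -2√Δ is cancellable: (-√Δ)(-2√Δ) = 2Δ, and p divides neither 2 nor Δ.
    -2s-cancellable : Cancellable (- s + - s)
    -2s-cancellable = cancellable-factor { - s} { - s + - s} -s*-2s≈2Δ (ι-cancellable p∤2Δ)
      where
      -s*-2s≈2Δ : - s * (- s + - s) ≈ ι (Δ ℤ.* + 2)
      -s*-2s≈2Δ = ≈-reflexive (ext (ℤ.+-identityˡ (Δ ℤ.* + 2)) ≡.refl)

      p∤2Δ : ¬ (Δ ℤ.* + 2 ∼ 0ℤ)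
      p∤2Δ 2Δ∼0 with *-∼0 Δ (+ 2) 2Δ∼0
      ... | inj₁ Δ∼0 = Δ≁0 Δ∼0
      ... | inj₂ 2∼0 = p≰2 (ℕ∣.∣⇒≤ (∣⇒∣ᵤ (∼0⇒∣ 2∼0)))

    -- B_p ≡ 1: cancel -2√Δ ≡ P from P · B_p ≡ P.
    B≈1 : B Δ p ≈ 1#
    B≈1 = -2s-cancellable (begin
      (- s + - s) * B Δ p ≈⟨ *-congʳ P≈-2s ⟨
      P * B Δ p           ≈⟨ P*B≈-2s ⟩
      - s + - s           ≈⟨ *-identityʳ _ ⟨
      (- s + - s) * 1#    ∎)

    B^n≈1 : ∀ n → pow√ Δ (B Δ p) n ≈ 1#
    B^n≈1 n = trans (≈-reflexive (pow√≡^ (B Δ p) n)) (trans (^-congˡ n B≈1) (1^n≈1 n))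

parity : ∀ n → (∃[ h ] n ≡ h ℕ.+ h) ⊎ (∃[ h ] n ≡ suc (h ℕ.+ h))
parity zero    = inj₁ (0 , ≡.refl)
parity (suc n) with parity n
... | inj₁ (h , n≡h+h)   = inj₂ (h , ≡.cong suc n≡h+h)
... | inj₂ (h , n≡1+h+h) = inj₁ (suc h , ≡.trans (≡.cong suc n≡1+h+h) (≡.cong suc (≡.sym (ℕ.+-suc h h))))

even-prime : ∀ {p} h → Prime p → p ≡ h ℕ.+ h → p ≡ 2
even-prime h p-prime p≡h+h with prime⇒irreducible p-prime (divides h (≡.trans p≡h+h h+h≡h*2))
  where
  h+h≡h*2 : h ℕ.+ h ≡ h ℕ.* 2
  h+h≡h*2 = ≡.trans (≡.cong (h ℕ.+_) (≡.sym (ℕ.+-identityʳ h))) (ℕ.*-comm 2 h)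
... | inj₁ ()
... | inj₂ 2≡p = ≡.sym 2≡p

odd-prime : ∀ {p} → Prime p → ¬ (p ≡ 2) → ∃[ h' ] p ≡ suc (suc h' ℕ.+ suc h')
odd-prime p-prime p≢2 with parity _
... | inj₁ (h , p≡h+h)       = ⊥-elim (p≢2 (even-prime h p-prime p≡h+h))
... | inj₂ (zero , p≡1)      = ⊥-elim (¬prime[1] (≡.subst Prime p≡1 p-prime))
... | inj₂ (suc h' , p≡2h+1) = h' , p≡2h+1

open import Data.Integer using (_-_)
open import Data.Integer.Divisibility using (_∣_)
open import Data.Nat using (_/_)

lemma2p2 : (p : ℕ) → Prime p → ¬ (p ≡ 2) → (Δ : ℤ) → (+ 4) ∣ (Δ - + 3) → QuadNonResidue Δ p →
    pow√ Δ (B Δ p) ((p ∸ 1) / 2) ≡ one√ Δ mod𝔭[ p ]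
lemma2p2 p p-prime p≢2 Δ _ nonresidue with odd-prime p-prime p≢2
... | h' , ≡.refl = ∣⇒∣ᵤ (p∣a-b (re∼ B^[p-1]/2≈1)) , ∣⇒∣ᵤ (p∣a-b (im∼ B^[p-1]/2≈1))
  where
  open QuadraticRing Δ p
  B^[p-1]/2≈1 : pow√ Δ (B Δ p) ((p ∸ 1) / 2) ≈ one√ Δ
  B^[p-1]/2≈1 = OddPrime.B^n≈1 Δ h' p-prime (λ x x²∼Δ → nonresidue x (∣⇒∣ᵤ (p∣a-b x²∼Δ))) ((p ∸ 1) / 2)
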